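{- (i) The partially ordered set $(\mathbf E,\subseteq)$ is a completely distributive complete lattice, with union as join, intersection as meet, $\emptyset$ as bottom and $\overline{\mathbf D}$ as top. (ii) The partially ordered set $(\mathbf E_{\mathrm{fin}},\subseteq)$ is a bounded distributive lattice, with union as join, intersection as meet, $\emptyset$ as bottom and $\overline{\mathbf D}$ as top. (iii) The partially ordered set $(\hat{\mathbf E}_{\mathrm{fin}},\subseteq)$ is a bounded distributive lattice, with union as join, intersection as meet, $\emptyset$ as bottom and $\overline{\mathbf D}$ as top.
   Context: Let $\mathcal T$ be a non-empty set (of "things"), $\mathrm{cl}:\mathcal P(\mathcal T)\to\mathcal P(\mathcal T)$ a closure operator (extensive, monotone, idempotent), $\mathcal T_-\subseteq\mathcal T$ a set of forbidden things, $\mathcal T_+:=\mathrm{cl}(\emptyset)$, with the standing assumption $\mathcal T_+\cap\mathcal T_-=\emptyset$. A coherent SDT is a $D\subseteq\mathcal T$ with $\mathrm{cl}(D)=D$ and $D\cap\mathcal T_-=\emptyset$; $\overline{\mathbf D}$ is the set of all coherent SDTs. $\mathcal Q(\mathcal T)$ denotes the set of finite subsets of $\mathcal T$ (including $\emptyset$). For $S\subseteq\mathcal T$ let $\overline{\mathbf D}_S:=\{D\in\overline{\mathbf D}:S\cap D\neq\emptyset\}$, and for $\mathcal W\subseteq\mathcal P(\mathcal T)$ let $E(\mathcal W):=\bigcap_{S\in\mathcal W}\overline{\mathbf D}_S$ (so $E(\emptyset)=\overline{\mathbf D}$). Let $\mathbf E:=\{E(\mathcal W):\mathcal W\subseteq\mathcal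 P(\mathcal T)\}$, $\mathbf E_{\mathrm{fin}}:=\{E(\mathcal W):\mathcal W\subseteq\mathcal P(\mathcal T)\text{ finite}\}$ and $\hat{\mathbf E}_{\mathrm{fin}}:=\{E(\mathcal V):\mathcal V\subseteq\mathcal Q(\mathcal T)\text{ finite}\}$. -}

module Defs where

open import Level using (Level; _⊔_; 0ℓ; Setω)
import Level
open import Data.Bool using (Bool; true; false)
open import Data.Product using (Σ; ∃; _×_)
open import Data.Empty using (⊥)
open import Data.List using (List)
open import Data.List.Relation.Unary.All using (All)
open import Data.List.Membership.Propositional using (_∈_)
open import Relation.Binary.PropositionalEquality using (_≡_)
open import Function.Bundles using (_⇔_)

-- Subsets of the set of things T are represented by characteristic
-- functions T → Bool (classically this is exactly the power set P(T)).
Subset : ∀ {a} → Set a → Set a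
Subset T = T → Bool

module _ {a} {T : Set a} where

  _⊆ₛ_ : Subset T → Subset T → Set a
  S ⊆ₛ S' = ∀ t → S t ≡ true → S' t ≡ true

  ∅ₛ : Subset T
  ∅ₛ _ = false

  record IsClosureOperator (cl : Subset T → Subset T) : Set a where
    field
      extensive  : ∀ S → S ⊆ₛ cl S
      monotone   : ∀ S S' → S ⊆ₛ S' → cl S ⊆ₛ cl S'
      idempotent : ∀ S t → cl (cl S) t ≡ cl S t

module Setup {a} {T : Set a} (cl : Subset T → Subset T) (T₋ : Subset T) where

  T₊ : Subset T
  T₊ = cl ∅ₛ

  Coherent : Subset T → Set a
  Coherent D = (∀ t → cl D t ≡ D t) × (∀ t → D t ≡ true → T₋ t ≡ true → ⊥)

  SDTSet : (ℓ : Level) → Set (a ⊔ Level.suc ℓ)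
  SDTSet ℓ = Subset T → Set ℓ

  Dbar : SDTSet a
  Dbar = Coherent

  Empty : SDTSet 0ℓ
  Empty _ = ⊥

  Meets : Subset T → Subset T → Set a
  Meets S D = ∃ λ t → (S t ≡ true) × (D t ≡ true)

  Dbar[_] : Subset T → SDTSet a
  Dbar[ S ] D = Coherent D × Meets S D

  -- E(W) = ⋂_{S ∈ W} D̄_S  (with E(∅) = D̄), for W ⊆ P(T)
  E : ∀ {ℓ} → (Subset T → Set ℓ) → SDTSet (a ⊔ ℓ)
  E W D = Coherent D × (∀ S → W S → Meets S D)

  -- E(W) for a finite W ⊆ P(T), given by a list enumerating it
  Efin : List (Subset T) → SDTSet a
  Efin W D = Coherent D × All (λ S → Meets S D) W

  Finite : Subset T → Set a
  Finite S = ∃ λ (xs : List T) → ∀ t → (S t ≡ true) ⇔ (t ∈ xs)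

  _≐_ : ∀ {ℓ ℓ'} → SDTSet ℓ → SDTSet ℓ' → Set _
  X ≐ Y = ∀ D → X D ⇔ Y D

  _⊆_ : ∀ {ℓ ℓ'} → SDTSet ℓ → SDTSet ℓ' → Set _
  X ⊆ Y = ∀ D → X D → Y D

  InE : ∀ {ℓ} → SDTSet ℓ → Set _
  InE {ℓ} X = Σ (Subset T → Set (a ⊔ ℓ)) λ W → X ≐ E W

  InEfin : ∀ {ℓ} → SDTSet ℓ → Set _
  InEfin X = Σ (List (Subset T)) λ W → X ≐ Efin W

  InEhatfin : ∀ {ℓ} → SDTSet ℓ → Set _
  InEhatfin X = Σ (List (Subset T)) λ V → All Finite V × (X ≐ Efin V)

  _∪_ : ∀ {ℓ ℓ'} → SDTSet ℓ → SDTSet ℓ' → SDTSet (ℓ ⊔ ℓ')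
  (X ∪ Y) D = X D Data.Sum.⊎ Y D
    where import Data.Sum

  _∩_ : ∀ {ℓ ℓ'} → SDTSet ℓ → SDTSet ℓ' → SDTSet (ℓ ⊔ ℓ')
  (X ∩ Y) D = X D × Y D

  ⋃ : ∀ {ι ℓ} (I : Set ι) → (I → SDTSet ℓ) → SDTSet (ι ⊔ ℓ)
  ⋃ I X D = Σ I λ i → X i D

  -- arbitrary intersection of a family, taken inside D̄
  -- (so the empty intersection is D̄, the top element)
  ⋂ : ∀ {ι ℓ} (I : Set ι) → (I → SDTSet ℓ) → SDTSet (a ⊔ ι ⊔ ℓ)
  ⋂ I X D = Coherent D × (∀ i → X i D)

  record Part-i : Setω where
    field
      bottom-in : InE Empty
      top-in    : InE Dbar
      top-max   : ∀ {ℓ} (X : SDTSet ℓ) → InE X → X ⊆ Dbar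
      join-in   : ∀ {ι ℓ} (I : Set ι) (X : I → SDTSet ℓ) →
                  (∀ i → InE (X i)) → InE (⋃ I X)
      meet-in   : ∀ {ι ℓ} (I : Set ι) (X : I → SDTSet ℓ) →
                  (∀ i → InE (X i)) → InE (⋂ I X)
      complete-distrib :
        ∀ {ι ℓ} (I : Set ι) (J : I → Set ι) (X : (i : I) → J i → SDTSet ℓ) →
        (∀ i j → InE (X i j)) →
        ⋂ I (λ i → ⋃ (J i) (X i)) ≐ ⋃ ((i : I) → J i) (λ f → ⋂ I (λ i → X i (f i)))

  record BoundedDistribLattice (In : ∀ {ℓ} → SDTSet ℓ → Set (a ⊔ ℓ)) : Setω where
    field
      bottom-in : In Empty
      top-in    : In Dbar
      top-max   : ∀ {ℓ} (X : SDTSet ℓ) → In X → X ⊆ Dbar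
      join-in   : ∀ {ℓ ℓ'} (X : SDTSet ℓ) (Y : SDTSet ℓ') → In X → In Y → In (X ∪ Y)
      meet-in   : ∀ {ℓ ℓ'} (X : SDTSet ℓ) (Y : SDTSet ℓ') → In X → In Y → In (X ∩ Y)
      distrib   : ∀ {ℓ₁ ℓ₂ ℓ₃} (X : SDTSet ℓ₁) (Y : SDTSet ℓ₂) (Z : SDTSet ℓ₃) →
                  In X → In Y → In Z → (X ∩ (Y ∪ Z)) ≐ ((X ∩ Y) ∪ (X ∩ Z))

  record Theorem3 : Setω where
    field
      part-i   : Part-i
      part-ii  : BoundedDistribLattice InEfin
      part-iii : BoundedDistribLattice InEhatfin

{-# OPTIONS --safe #-}
-- Classically, a set of coherent SDTs belongs to 𝐄 exactly when it is an
-- up-set of (D̄, ⊆): each E(W) is visibly up-closed, and an up-set X equals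
-- E(W) for W the complements of the coherent SDTs outside X.  Up-sets are
-- closed under arbitrary unions and intersections, which distribute as in
-- any powerset.  For finite W, W′ we have E(W) ∩ E(W′) = E(W ++ W′) and
-- E(W) ∪ E(W′) = E({S ∪ S′ : S ∈ W, S′ ∈ W′}), because D misses S ∪ S′
-- iff it misses both S and S′; and unions of finite sets are finite.
module Submission where

open import Defs
open import Data.Bool using (true)
open import Data.Empty using (⊥)
open import Relation.Binary.PropositionalEquality using (_≡_)
open import Axiom.ExcludedMiddle using (ExcludedMiddle)

open import Level using (Level; _⊔_)
open import Data.Bool using (false; not; _∨_)
open import Data.Empty using (⊥-elim)
open import Data.Product using (∃; ∃₂; _×_; _,_; proj₁; proj₂)
open import Data.Product.Function.NonDependent.Propositional using (_×-⇔_)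
open import Data.Sum using (_⊎_; inj₁; inj₂; [_,_]′)
open import Data.Sum.Function.Propositional using (_⊎-⇔_)
open import Data.List using (List; []; [_]; _++_; cartesianProductWith)
open import Data.List.Relation.Unary.All as All using (All)
open import Data.List.Relation.Unary.All.Properties using (++⁺; ++⁻; ¬All⇒Any¬)
open import Data.List.Relation.Unary.Any.Properties using (++↔)
open import Data.List.Membership.Propositional using (_∈_; find)
open import Data.List.Membership.Propositional.Properties
  using (∈-cartesianProductWith⁺; ∈-cartesianProductWith⁻)
open import Relation.Binary.PropositionalEquality using (refl; cong)
open import Relation.Nullary using (¬_; yes; no)
open import Relation.Nullary.Decidable using (decidable-stable)
open import Function.Bundles using (_⇔_; mk⇔; Equivalence)
open import Function.Properties.Inverse using (↔⇒⇔)
import Function.Properties.Equivalence as ⇔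

open Equivalence using (to; from)

∨≡true⇔ : ∀ {b c} → b ∨ c ≡ true ⇔ (b ≡ true ⊎ c ≡ true)
∨≡true⇔ {true}  {c} = mk⇔ inj₁ (λ _ → refl)
∨≡true⇔ {false} {c} = mk⇔ inj₂ [ (λ ()) , (λ c≡true → c≡true) ]′

module _ {a} {T : Set a} where

  infixr 6 _∪ₛ_

  _∪ₛ_ : Subset T → Subset T → Subset T
  (S ∪ₛ S′) t = S t ∨ S′ t

  ∁ₛ : Subset T → Subset T
  ∁ₛ S t = not (S t)

module _ {a} {T : Set a} (cl : Subset T → Subset T) (T₋ : Subset T) where
  open Setup cl T₋

  private
    variable
      ℓ ι : Level
      X Y Z : SDTSet ℓ
      X′ Y′ : SDTSet ℓ
      S S′ D D′ : Subset T

  Finite-∅ : Finite ∅ₛ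
  Finite-∅ = [] , λ t → mk⇔ (λ ()) (λ ())

  Finite-∪ : Finite S → Finite S′ → Finite (S ∪ₛ S′)
  Finite-∪ (xs , S≡xs) (ys , S′≡ys) =
    xs ++ ys , λ t → ⇔.trans ∨≡true⇔ (⇔.trans (S≡xs t ⊎-⇔ S′≡ys t) (↔⇒⇔ ++↔))

  ≐-sym : X ≐ Y → Y ≐ X
  ≐-sym X≐Y D = ⇔.sym (X≐Y D)

  ≐-trans : X ≐ Y → Y ≐ Z → X ≐ Z
  ≐-trans X≐Y Y≐Z D = ⇔.trans (X≐Y D) (Y≐Z D)

  ∪-cong : X ≐ X′ → Y ≐ Y′ → (X ∪ Y) ≐ (X′ ∪ Y′)
  ∪-cong X≐X′ Y≐Y′ D = X≐X′ D ⊎-⇔ Y≐Y′ D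

  ∩-cong : X ≐ X′ → Y ≐ Y′ → (X ∩ Y) ≐ (X′ ∩ Y′)
  ∩-cong X≐X′ Y≐Y′ D = X≐X′ D ×-⇔ Y≐Y′ D

  ∩-distribˡ-∪ : (X ∩ (Y ∪ Z)) ≐ ((X ∩ Y) ∪ (X ∩ Z))
  ∩-distribˡ-∪ D = mk⇔
    (λ { (x , inj₁ y) → inj₁ (x , y) ; (x , inj₂ z) → inj₂ (x , z) })
    (λ { (inj₁ (x , y)) → x , inj₁ y ; (inj₂ (x , z)) → x , inj₂ z })

  ⋂-distrib-⋃ : (I : Set ι) (J : I → Set ι) (X : (i : I) → J i → SDTSet ℓ) →
                ⋂ I (λ i → ⋃ (J i) (X i)) ≐ ⋃ ((i : I) → J i) (λ f → ⋂ I (λ i → X i (f i)))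
  ⋂-distrib-⋃ I J X D = mk⇔
    (λ (c , g) → (λ i → proj₁ (g i)) , c , λ i → proj₂ (g i))
    (λ (f , c , g) → c , λ i → f i , g i)

  Meets-mono : D ⊆ₛ D′ → Meets S D → Meets S D′
  Meets-mono D⊆D′ (t , St , Dt) = t , St , D⊆D′ t Dt

  ¬Meets-∅ : ¬ Meets ∅ₛ D
  ¬Meets-∅ (_ , () , _)

  ¬Meets-∁ : ¬ Meets (∁ₛ D) D
  ¬Meets-∁ {D} (t , ∁Dt , Dt) with D t
  ¬Meets-∁ (t , () , Dt) | true
  ¬Meets-∁ (t , ∁Dt , ()) | false

  ¬Meets-∁⇒⊆ : ¬ Meets (∁ₛ D′) D → D ⊆ₛ D′
  ¬Meets-∁⇒⊆ {D′} ¬meets t Dt with D′ t in D′t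
  ... | true  = refl
  ... | false = ⊥-elim (¬meets (t , cong not D′t , Dt))

  Meets-∪ˡ : Meets S D → Meets (S ∪ₛ S′) D
  Meets-∪ˡ (t , St , Dt) = t , from ∨≡true⇔ (inj₁ St) , Dt

  Meets-∪ʳ : Meets S′ D → Meets (S ∪ₛ S′) D
  Meets-∪ʳ (t , S′t , Dt) = t , from ∨≡true⇔ (inj₂ S′t) , Dt

  Meets-∪-resolve : ¬ Meets S D → Meets (S ∪ₛ S′) D → Meets S′ D
  Meets-∪-resolve ¬meets (t , S∪S′t , Dt) with to ∨≡true⇔ S∪S′t
  ... | inj₁ St  = ⊥-elim (¬meets (t , St , Dt))
  ... | inj₂ S′t = t , S′t , Dt

  UpClosed : SDTSet ℓ → Set (a ⊔ ℓ)
  UpClosed X = ∀ {D D′} → Coherent D′ → D ⊆ₛ D′ → X D → X D′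

  InE⇒⊆Dbar : InE X → X ⊆ Dbar
  InE⇒⊆Dbar (W , X≐EW) D x = proj₁ (to (X≐EW D) x)

  InE⇒UpClosed : InE X → UpClosed X
  InE⇒UpClosed (W , X≐EW) cD′ D⊆D′ x =
    from (X≐EW _) (cD′ , λ S S∈W → Meets-mono D⊆D′ (proj₂ (to (X≐EW _) x) S S∈W))

  ∁Outside : SDTSet ℓ → Subset T → Set (a ⊔ ℓ)
  ∁Outside X S = ∃ λ D′ → Coherent D′ × ¬ X D′ × S ≡ ∁ₛ D′

  UpClosed⇒InE : (∀ {p} → ExcludedMiddle p) → X ⊆ Dbar → UpClosed X → InE X
  UpClosed⇒InE {X = X} em X⊆Dbar up = ∁Outside X , λ D → mk⇔ (into D) (outOf D)
    where
    into : ∀ D → X D → E (∁Outside X) D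
    into D x = X⊆Dbar D x , λ where
      _ (D′ , cD′ , ¬xD′ , refl) → decidable-stable em λ ¬meets →
        ¬xD′ (up cD′ (¬Meets-∁⇒⊆ ¬meets) x)
    outOf : ∀ D → E (∁Outside X) D → X D
    outOf D (cD , meets) = decidable-stable em λ ¬x →
      ¬Meets-∁ (meets (∁ₛ D) (D , cD , ¬x , refl))

  infixr 6 _⊗_

  _⊗_ : List (Subset T) → List (Subset T) → List (Subset T)
  _⊗_ = cartesianProductWith _∪ₛ_

  All-⊗ : ∀ {p} {P : Subset T → Set p} {W W′} →
          (∀ {S S′} → S ∈ W → S′ ∈ W′ → P (S ∪ₛ S′)) → All P (W ⊗ W′)
  All-⊗ {P = P} {W} {W′} P∪ = All.tabulate λ v∈W⊗W′ →
    P-pair (∈-cartesianProductWith⁻ _∪ₛ_ W W′ v∈W⊗W′)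
    where
    P-pair : ∀ {v} → ∃₂ (λ S S′ → S ∈ W × S′ ∈ W′ × v ≡ S ∪ₛ S′) → P v
    P-pair (_ , _ , S∈W , S′∈W′ , refl) = P∪ S∈W S′∈W′

  All-Finite-⊗ : ∀ {W W′} → All Finite W → All Finite W′ → All Finite (W ⊗ W′)
  All-Finite-⊗ fin fin′ = All-⊗ λ S∈W S′∈W′ →
    Finite-∪ (All.lookup fin S∈W) (All.lookup fin′ S′∈W′)

  Efin⊆Dbar : ∀ W → Efin W ⊆ Dbar
  Efin⊆Dbar W D = proj₁

  Dbar≐Efin[] : Dbar ≐ Efin []
  Dbar≐Efin[] D = mk⇔ (λ cD → cD , All.[]) proj₁

  Empty≐Efin[∅] : Empty ≐ Efin [ ∅ₛ ]
  Empty≐Efin[∅] D = mk⇔ (λ ()) (λ { (_ , meets All.∷ _) → ¬Meets-∅ meets })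

  Efin-++ : ∀ W W′ → Efin (W ++ W′) ≐ (Efin W ∩ Efin W′)
  Efin-++ W W′ D = mk⇔
    (λ (cD , meets) → let m , m′ = ++⁻ W meets in (cD , m) , (cD , m′))
    (λ ((cD , m) , (_ , m′)) → cD , ++⁺ m m′)

  module _ (em : ∀ {p} → ExcludedMiddle p) where

    InE-Empty : InE Empty
    InE-Empty = UpClosed⇒InE em (λ _ ()) (λ _ _ ())

    InE-Dbar : InE Dbar
    InE-Dbar = UpClosed⇒InE em (λ _ cD → cD) (λ cD′ _ _ → cD′)

    InE-⋃ : (I : Set ι) (X : I → SDTSet ℓ) → (∀ i → InE (X i)) → InE (⋃ I X)
    InE-⋃ I X inE = UpClosed⇒InE em
      (λ D (i , x) → InE⇒⊆Dbar (inE i) D x)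
      (λ cD′ D⊆D′ (i , x) → i , InE⇒UpClosed (inE i) cD′ D⊆D′ x)

    InE-⋂ : (I : Set ι) (X : I → SDTSet ℓ) → (∀ i → InE (X i)) → InE (⋂ I X)
    InE-⋂ I X inE = UpClosed⇒InE em
      (λ D (cD , _) → cD)
      (λ cD′ D⊆D′ (_ , x) → cD′ , λ i → InE⇒UpClosed (inE i) cD′ D⊆D′ (x i))

    𝐄-completeLattice : Part-i
    𝐄-completeLattice = record
      { bottom-in        = InE-Empty
      ; top-in           = InE-Dbar
      ; top-max          = λ X → InE⇒⊆Dbar
      ; join-in          = InE-⋃
      ; meet-in          = InE-⋂
      ; complete-distrib = λ I J X _ → ⋂-distrib-⋃ I J X
      }

    All-Meets-⊗⁻ : ∀ {D} W W′ → All (λ S → Meets S D) (W ⊗ W′) →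
                   All (λ S → Meets S D) W ⊎ All (λ S → Meets S D) W′
    All-Meets-⊗⁻ {D} W W′ meets with em {P = All (λ S → Meets S D) W}
    ... | yes meetsW = inj₁ meetsW
    ... | no ¬meetsW with find (¬All⇒Any¬ (λ _ → em) W ¬meetsW)
    ... | _ , S∈W , ¬meetsS = inj₂ (All.tabulate λ S′∈W′ →
      Meets-∪-resolve ¬meetsS (All.lookup meets (∈-cartesianProductWith⁺ _∪ₛ_ S∈W S′∈W′)))

    Efin-⊗ : ∀ W W′ → Efin (W ⊗ W′) ≐ (Efin W ∪ Efin W′)
    Efin-⊗ W W′ D = mk⇔
      (λ (cD , meets) → [ (λ m → inj₁ (cD , m)) , (λ m′ → inj₂ (cD , m′)) ]′
                         (All-Meets-⊗⁻ W W′ meets))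
      λ { (inj₁ (cD , m))  → cD , All-⊗ {W = W} {W′} λ S∈W _ → Meets-∪ˡ (All.lookup m S∈W)
        ; (inj₂ (cD , m′)) → cD , All-⊗ {W = W} {W′} λ _ S′∈W′ → Meets-∪ʳ (All.lookup m′ S′∈W′) }

    ∪-≐Efin : ∀ {W W′} → X ≐ Efin W → Y ≐ Efin W′ → (X ∪ Y) ≐ Efin (W ⊗ W′)
    ∪-≐Efin {W = W} {W′} X≐ Y≐ = ≐-trans (∪-cong X≐ Y≐) (≐-sym (Efin-⊗ W W′))

    ∩-≐Efin : ∀ {W W′} → X ≐ Efin W → Y ≐ Efin W′ → (X ∩ Y) ≐ Efin (W ++ W′)
    ∩-≐Efin {W = W} {W′} X≐ Y≐ = ≐-trans (∩-cong X≐ Y≐) (≐-sym (Efin-++ W W′))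

    𝐄fin-distribLattice : BoundedDistribLattice InEfin
    𝐄fin-distribLattice = record
      { bottom-in = [ ∅ₛ ] , Empty≐Efin[∅]
      ; top-in    = [] , Dbar≐Efin[]
      ; top-max   = λ X (W , X≐) D x → Efin⊆Dbar W D (to (X≐ D) x)
      ; join-in   = λ X Y (W , X≐) (W′ , Y≐) → W ⊗ W′ , ∪-≐Efin X≐ Y≐
      ; meet-in   = λ X Y (W , X≐) (W′ , Y≐) → W ++ W′ , ∩-≐Efin X≐ Y≐
      ; distrib   = λ X Y Z _ _ _ → ∩-distribˡ-∪
      }

    𝐄̂fin-distribLattice : BoundedDistribLattice InEhatfin
    𝐄̂fin-distribLattice = record
      { bottom-in = [ ∅ₛ ] , Finite-∅ All.∷ All.[] , Empty≐Efin[∅]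
      ; top-in    = [] , All.[] , Dbar≐Efin[]
      ; top-max   = λ X (W , _ , X≐) D x → Efin⊆Dbar W D (to (X≐ D) x)
      ; join-in   = λ X Y (W , fin , X≐) (W′ , fin′ , Y≐) →
                      W ⊗ W′ , All-Finite-⊗ fin fin′ , ∪-≐Efin X≐ Y≐
      ; meet-in   = λ X Y (W , fin , X≐) (W′ , fin′ , Y≐) →
                      W ++ W′ , ++⁺ fin fin′ , ∩-≐Efin X≐ Y≐
      ; distrib   = λ X Y Z _ _ _ → ∩-distribˡ-∪
      }

theorem3 : (lem : ∀ {p} → ExcludedMiddle p) →
             ∀ {a} (T : Set a) → T →
             (cl : Subset T → Subset T) → IsClosureOperator cl →
             (T₋ : Subset T) →
             (∀ t → Setup.T₊ cl T₋ t ≡ true → T₋ t ≡ true → ⊥) →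
             Setup.Theorem3 cl T₋
theorem3 lem T _ cl _ T₋ _ = record
  { part-i   = 𝐄-completeLattice cl T₋ lem
  ; part-ii  = 𝐄fin-distribLattice cl T₋ lem
  ; part-iii = 𝐄̂fin-distribLattice cl T₋ lem
  }
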